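{- Let $k\geq1$ and let $a=[a_0;a_1,\dots,a_{k-1}]$ be the even- or odd-length continued fraction expansion of a positive rational number. Then $\mathcal{P}(a)\cap\mathbb{Z}^k=\mathcal{B}(a)$, where $\mathcal{P}(a)=\mathrm{conv}(\mathcal{B}(a))\subset\mathbb{R}^k$.
   Context: $a_0\geq0$ and $a_i\geq1$ for $1\leq i<k$. A sequence of integers $(b_i)_{0\leq i<k}$ is admissible for $a$ if: $0\leq b_i\leq a_i$ for all $i$; if $i>0$ is odd and $b_i=a_i$ then $b_{i-1}=a_{i-1}$; if $i>0$ is even and $b_i=0$ then $b_{i-1}=0$. $\mathcal{B}(a)\subset\mathbb{Z}^k$ is the set of admissible sequences for $a$, and $\mathrm{conv}$ denotes convex hull.
   Formalization: The convex hull $\mathcal{P}(a)$ is taken with nonnegative rational coefficients, as a subset of ℚ^k rather than ℝ^k. -}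

module Defs where

open import Data.Nat as ℕ using (ℕ; zero; suc; _<_; _≤_; _%_)
open import Data.Nat.Properties using (<-trans; n<1+n)
open import Data.Integer as ℤ using (ℤ; +_)
open import Data.Rational as ℚ using (ℚ; _/_; 0ℚ; 1ℚ)
open import Data.Fin using (Fin; fromℕ<)
open import Data.List using (List; map; sum; foldr)
open import Data.List.Relation.Unary.All using (All)
open import Data.Product using (_×_; Σ; proj₁; proj₂)
open import Relation.Binary.PropositionalEquality using (_≡_)

pred< : ∀ {m k} → suc m < k → m < k
pred< {m} p = <-trans (n<1+n m) p

-- a : Fin k → ℕ is the continued fraction [a_0; a_1, ..., a_{k-1}]
-- (index i of Fin k ↔ a_i). b : Fin k → ℤ.
record Admissible (k : ℕ) (a : Fin k → ℕ) (b : Fin k → ℤ) : Set where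
  field
    lower : ∀ i → + 0 ℤ.≤ b i
    upper : ∀ i → b i ℤ.≤ + a i
    odd-cond : ∀ m (p : suc m < k) → suc m % 2 ≡ 1 →
      b (fromℕ< p) ≡ + a (fromℕ< p) →
      b (fromℕ< (pred< p)) ≡ + a (fromℕ< (pred< p))
    even-cond : ∀ m (p : suc m < k) → suc m % 2 ≡ 0 →
      b (fromℕ< p) ≡ + 0 →
      b (fromℕ< (pred< p)) ≡ + 0

toℚ : ℤ → ℚ
toℚ z = z / 1

sumℚ : List ℚ → ℚ
sumℚ = foldr ℚ._+_ 0ℚ

InConvexHull : (k : ℕ) → ((Fin k → ℤ) → Set) → (Fin k → ℚ) → Set
InConvexHull k P x =
  Σ (List (ℚ × (Fin k → ℤ))) λ cs →
    All (λ c → (0ℚ ℚ.≤ proj₁ c) × P (proj₂ c)) cs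
    × sumℚ (map proj₁ cs) ≡ 1ℚ
    × (∀ i → sumℚ (map (λ c → proj₁ c ℚ.* toℚ (proj₂ c i)) cs) ≡ x i)

-- standing hypotheses: a_0 ≥ 0 (automatic in ℕ), a_i ≥ 1 for 1 ≤ i < k,
-- and the value [a_0; a_1, ..., a_{k-1}] is a positive rational
-- (equivalently, given the above: k ≥ 2 or a_0 ≥ 1).
record ValidCF (k : ℕ) (a : Fin k → ℕ) : Set where
  field
    tail-pos : ∀ m (p : suc m < k) → 1 ≤ a (fromℕ< p)
    positive : (p : 0 < k) → k ≡ 1 → 1 ≤ a (fromℕ< p)

{-# OPTIONS --safe #-}
-- The box inequalities 0 ≤ b_i ≤ a_i pass to convex combinations.  Each
-- implication in the definition of admissibility says that a point on the face
-- {b_i = a_i} (resp. {b_i = 0}) of the box lies on the face {b_{i-1} = a_{i-1}}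
-- (resp. {b_{i-1} = 0}).  Such a face is the zero set of a functional that is
-- nonnegative on the box (a_i - b_i, resp. b_i), so a convex combination lies
-- on it only if every point with positive weight does; hence the implications
-- pass to the hull as well.
module Submission where

open import Defs
open import Data.Nat using (ℕ; _≤_; suc; _<_; _%_)
open import Data.Integer using (ℤ)
open import Data.Fin using (Fin; fromℕ<)
open import Data.Product using (_×_; _,_; proj₁; proj₂)

open import Data.Integer as ℤ using (+_)
open import Data.Integer.GCD using (gcd; gcd-zeroʳ)
import Data.Integer.Properties as ℤ
open import Data.List using (List; []; _∷_; map)
open import Data.List.Relation.Unary.All using (All; []; _∷_)
open import Data.Rational as ℚ using (ℚ; ↥_; ↧_; 0ℚ; 1ℚ; _+_; _*_; _-_; -_; 1/_)
import Data.Rational.Properties as ℚ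
open import Algebra.Properties.Group ℚ.+-0-group using (x∙y⁻¹≈ε⇒x≈y; //-rightDividesˡ)
open import Data.Rational.Solver using (module +-*-Solver)
open import Data.Sum using (_⊎_; inj₁; inj₂)
open import Function using (_∘_)
open import Relation.Binary.PropositionalEquality
open import Relation.Nullary using (yes; no)

↥-toℚ : ∀ z → ↥ toℚ z ≡ z
↥-toℚ z = begin
  ↥ toℚ z                    ≡⟨ sym (ℤ.*-identityʳ _) ⟩
  ↥ toℚ z ℤ.* + 1            ≡⟨ cong (↥ toℚ z ℤ.*_) (sym (gcd-zeroʳ z)) ⟩
  ↥ toℚ z ℤ.* gcd z (+ 1)    ≡⟨ ℚ.↥-/ z 1 ⟩
  z                          ∎
  where open ≡-Reasoning

↧-toℚ : ∀ z → ↧ toℚ z ≡ + 1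
↧-toℚ z = begin
  ↧ toℚ z                    ≡⟨ sym (ℤ.*-identityʳ _) ⟩
  ↧ toℚ z ℤ.* + 1            ≡⟨ cong (↧ toℚ z ℤ.*_) (sym (gcd-zeroʳ z)) ⟩
  ↧ toℚ z ℤ.* gcd z (+ 1)    ≡⟨ ℚ.↧-/ z 1 ⟩
  + 1                        ∎
  where open ≡-Reasoning

toℚ-injective : ∀ {z w} → toℚ z ≡ toℚ w → z ≡ w
toℚ-injective {z} {w} eq = trans (sym (↥-toℚ z)) (trans (cong ↥_ eq) (↥-toℚ w))

↥toℚ*↧toℚ : ∀ z w → ↥ toℚ z ℤ.* ↧ toℚ w ≡ z
↥toℚ*↧toℚ z w = trans (cong₂ ℤ._*_ (↥-toℚ z) (↧-toℚ w)) (ℤ.*-identityʳ z)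

toℚ-mono-≤ : ∀ {z w} → z ℤ.≤ w → toℚ z ℚ.≤ toℚ w
toℚ-mono-≤ {z} {w} z≤w = ℚ.*≤* (subst₂ ℤ._≤_ (sym (↥toℚ*↧toℚ z w)) (sym (↥toℚ*↧toℚ w z)) z≤w)

toℚ-cancel-≤ : ∀ {z w} → toℚ z ℚ.≤ toℚ w → z ℤ.≤ w
toℚ-cancel-≤ {z} {w} z≤w = subst₂ ℤ._≤_ (↥toℚ*↧toℚ z w) (↥toℚ*↧toℚ w z) (ℚ.drop-*≤* z≤w)

p≤q⇒0≤q-p : ∀ {p q} → p ℚ.≤ q → 0ℚ ℚ.≤ q - p
p≤q⇒0≤q-p {p} {q} p≤q = subst (ℚ._≤ q - p) (ℚ.+-inverseʳ p) (ℚ.+-monoˡ-≤ (- p) p≤q)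

0≤q-p⇒p≤q : ∀ {p q} → 0ℚ ℚ.≤ q - p → p ℚ.≤ q
0≤q-p⇒p≤q {p} {q} 0≤q-p = subst₂ ℚ._≤_ (ℚ.+-identityˡ p) (//-rightDividesˡ p q) (ℚ.+-monoˡ-≤ p 0≤q-p)

*-nonNeg : ∀ {p q} → 0ℚ ℚ.≤ p → 0ℚ ℚ.≤ q → 0ℚ ℚ.≤ p * q
*-nonNeg {p} {q} 0≤p 0≤q = ℚ.nonNegative⁻¹ (p * q)
  {{ℚ.nonNeg*nonNeg⇒nonNeg p {{ℚ.nonNegative 0≤p}} q {{ℚ.nonNegative 0≤q}}}}

+-nonNeg : ∀ {p q} → 0ℚ ℚ.≤ p → 0ℚ ℚ.≤ q → 0ℚ ℚ.≤ p + q
+-nonNeg {p} {q} 0≤p 0≤q = ℚ.nonNegative⁻¹ (p + q)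
  {{ℚ.nonNeg+nonNeg⇒nonNeg p {{ℚ.nonNegative 0≤p}} q {{ℚ.nonNegative 0≤q}}}}

nonNeg+nonNeg≡0⇒≡0 : ∀ {p q} → 0ℚ ℚ.≤ p → 0ℚ ℚ.≤ q → p + q ≡ 0ℚ → p ≡ 0ℚ × q ≡ 0ℚ
nonNeg+nonNeg≡0⇒≡0 {p} {q} 0≤p 0≤q p+q≡0 =
  ℚ.≤-antisym (subst₂ ℚ._≤_ (ℚ.+-identityʳ p) p+q≡0 (ℚ.+-monoʳ-≤ p 0≤q)) 0≤p ,
  ℚ.≤-antisym (subst₂ ℚ._≤_ (ℚ.+-identityˡ q) p+q≡0 (ℚ.+-monoˡ-≤ q 0≤p)) 0≤q

p*q≡0⇒p≡0∨q≡0 : ∀ p q → p * q ≡ 0ℚ → p ≡ 0ℚ ⊎ q ≡ 0ℚ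
p*q≡0⇒p≡0∨q≡0 p q pq≡0 with p ℚ.≟ 0ℚ
... | yes p≡0 = inj₁ p≡0
... | no  p≢0 = inj₂ (begin
  q                ≡⟨ sym (ℚ.*-identityˡ q) ⟩
  1ℚ * q           ≡⟨ cong (_* q) (sym (ℚ.*-inverseˡ p)) ⟩
  (1/ p * p) * q   ≡⟨ ℚ.*-assoc (1/ p) p q ⟩
  1/ p * (p * q)   ≡⟨ cong (1/ p *_) pq≡0 ⟩
  1/ p * 0ℚ        ≡⟨ ℚ.*-zeroʳ (1/ p) ⟩
  0ℚ               ∎)
  where
  open ≡-Reasoning
  instance
    _ : ℚ.NonZero p
    _ = ℚ.≢-nonZero p≢0

weightedSum : {V : Set} → (V → ℚ) → List (ℚ × V) → ℚ
weightedSum f cs = sumℚ (map (λ c → proj₁ c * f (proj₂ c)) cs)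

totalWeight : {V : Set} → List (ℚ × V) → ℚ
totalWeight cs = sumℚ (map proj₁ cs)

NonNegCombination : {V : Set} → (V → Set) → List (ℚ × V) → Set
NonNegCombination P = All (λ c → (0ℚ ℚ.≤ proj₁ c) × P (proj₂ c))

weightedSum-const-minus : {V : Set} (c : ℚ) (f : V → ℚ) (cs : List (ℚ × V)) →
  weightedSum (λ v → c - f v) cs ≡ c * totalWeight cs - weightedSum f cs
weightedSum-const-minus c f [] = solve 1 (λ c → con 0ℚ := c :* con 0ℚ :- con 0ℚ) refl c
  where open +-*-Solver
weightedSum-const-minus c f ((l , v) ∷ cs) = begin
  l * (c - f v) + weightedSum (λ v → c - f v) cs
    ≡⟨ cong (_+_ (l * (c - f v))) (weightedSum-const-minus c f cs) ⟩
  l * (c - f v) + (c * totalWeight cs - weightedSum f cs)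
    ≡⟨ solve 5 (λ c l fv L s → l :* (c :- fv) :+ (c :* L :- s) := c :* (l :+ L) :- (l :* fv :+ s))
         refl c l (f v) (totalWeight cs) (weightedSum f cs) ⟩
  c * (l + totalWeight cs) - (l * f v + weightedSum f cs)
    ∎
  where
  open ≡-Reasoning
  open +-*-Solver

module _ {V : Set} {P : V → Set} where

  weightedSum-nonNeg : ∀ {cs} (f : V → ℚ) → (∀ {v} → P v → 0ℚ ℚ.≤ f v) →
    NonNegCombination P cs → 0ℚ ℚ.≤ weightedSum f cs
  weightedSum-nonNeg f f≥0 [] = ℚ.≤-refl
  weightedSum-nonNeg f f≥0 ((0≤l , pv) ∷ comb) =
    +-nonNeg (*-nonNeg 0≤l (f≥0 pv)) (weightedSum-nonNeg f f≥0 comb)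

  weightedSum-face : ∀ {cs} (f g : V → ℚ) → (∀ {v} → P v → 0ℚ ℚ.≤ f v) →
    (∀ {v} → P v → f v ≡ 0ℚ → g v ≡ 0ℚ) →
    NonNegCombination P cs → weightedSum f cs ≡ 0ℚ → weightedSum g cs ≡ 0ℚ
  weightedSum-face f g f≥0 f≡0⇒g≡0 [] _ = refl
  weightedSum-face {(l , v) ∷ cs} f g f≥0 f≡0⇒g≡0 ((0≤l , pv) ∷ comb) sum≡0 = begin
    l * g v + weightedSum g cs  ≡⟨ cong₂ _+_ head≡0 tail≡0 ⟩
    0ℚ + 0ℚ                     ≡⟨ ℚ.+-identityʳ 0ℚ ⟩
    0ℚ                          ∎
    where
    open ≡-Reasoning
    parts≡0 : l * f v ≡ 0ℚ × weightedSum f cs ≡ 0ℚ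
    parts≡0 = nonNeg+nonNeg≡0⇒≡0 (*-nonNeg 0≤l (f≥0 pv)) (weightedSum-nonNeg f f≥0 comb) sum≡0
    head≡0 : l * g v ≡ 0ℚ
    head≡0 with p*q≡0⇒p≡0∨q≡0 l (f v) (proj₁ parts≡0)
    ... | inj₁ l≡0  = trans (cong (_* g v) l≡0) (ℚ.*-zeroˡ (g v))
    ... | inj₂ fv≡0 = trans (cong (l *_) (f≡0⇒g≡0 pv fv≡0)) (ℚ.*-zeroʳ l)
    tail≡0 : weightedSum g cs ≡ 0ℚ
    tail≡0 = weightedSum-face f g f≥0 f≡0⇒g≡0 comb (proj₂ parts≡0)

∈⇒inConvexHull : ∀ {k} {P : (Fin k → ℤ) → Set} {x} → P x → InConvexHull k P (λ i → toℚ (x i))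
∈⇒inConvexHull {x = x} px =
  (1ℚ , x) ∷ [] , (ℚ.nonNegative⁻¹ 1ℚ , px) ∷ [] , refl ,
  λ i → trans (ℚ.+-identityʳ _) (ℚ.*-identityˡ _)

module _ {k : ℕ} (a : Fin k → ℕ) where

  coord : Fin k → (Fin k → ℤ) → ℚ
  coord i v = toℚ (v i)

  slack : Fin k → (Fin k → ℤ) → ℚ
  slack i v = toℚ (+ a i) - toℚ (v i)

  coord≡0⇒≡0 : ∀ i v → coord i v ≡ 0ℚ → v i ≡ + 0
  coord≡0⇒≡0 i v = toℚ-injective

  slack≡0⇒≡a : ∀ i v → slack i v ≡ 0ℚ → v i ≡ + a i
  slack≡0⇒≡a i v = sym ∘ toℚ-injective ∘ x∙y⁻¹≈ε⇒x≈y (toℚ (+ a i)) (toℚ (v i))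

  ≡a⇒slack≡0 : ∀ i v → v i ≡ + a i → slack i v ≡ 0ℚ
  ≡a⇒slack≡0 i v vi≡ai =
    trans (cong (λ z → toℚ (+ a i) - toℚ z) vi≡ai) (ℚ.+-inverseʳ (toℚ (+ a i)))

  coord-nonNeg : ∀ i {v} → Admissible k a v → 0ℚ ℚ.≤ coord i v
  coord-nonNeg i adm = toℚ-mono-≤ (Admissible.lower adm i)

  slack-nonNeg : ∀ i {v} → Admissible k a v → 0ℚ ℚ.≤ slack i v
  slack-nonNeg i adm = p≤q⇒0≤q-p (toℚ-mono-≤ (Admissible.upper adm i))

  inConvexHull⇒admissible : ∀ x → InConvexHull k (Admissible k a) (λ i → toℚ (x i)) → Admissible k a x
  inConvexHull⇒admissible x (cs , comb , total≡1 , barycentre) = record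
    { lower     = λ i → toℚ-cancel-≤ (subst (0ℚ ℚ.≤_) (barycentre i) (coord-average-nonNeg i))
    ; upper     = λ i → toℚ-cancel-≤ (0≤q-p⇒p≤q
                    (subst (0ℚ ℚ.≤_) (barycentre-slack i) (slack-average-nonNeg i)))
    ; odd-cond  = odd-cond
    ; even-cond = even-cond
    }
    where
    open ≡-Reasoning

    coord-average-nonNeg : ∀ i → 0ℚ ℚ.≤ weightedSum (coord i) cs
    coord-average-nonNeg i = weightedSum-nonNeg (coord i) (coord-nonNeg i) comb

    slack-average-nonNeg : ∀ i → 0ℚ ℚ.≤ weightedSum (slack i) cs
    slack-average-nonNeg i = weightedSum-nonNeg (slack i) (slack-nonNeg i) comb

    barycentre-slack : ∀ i → weightedSum (slack i) cs ≡ slack i x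
    barycentre-slack i = begin
      weightedSum (slack i) cs
        ≡⟨ weightedSum-const-minus (toℚ (+ a i)) (coord i) cs ⟩
      toℚ (+ a i) * totalWeight cs - weightedSum (coord i) cs
        ≡⟨ cong (_- weightedSum (coord i) cs) (cong (toℚ (+ a i) *_) total≡1) ⟩
      toℚ (+ a i) * 1ℚ - weightedSum (coord i) cs
        ≡⟨ cong₂ _-_ (ℚ.*-identityʳ (toℚ (+ a i))) (barycentre i) ⟩
      slack i x
        ∎

    odd-cond : ∀ m (p : suc m < k) → suc m % 2 ≡ 1 →
      x (fromℕ< p) ≡ + a (fromℕ< p) → x (fromℕ< (pred< p)) ≡ + a (fromℕ< (pred< p))
    odd-cond m p odd xi≡ai = slack≡0⇒≡a j x (begin
      slack j x                 ≡⟨ barycentre-slack j ⟨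
      weightedSum (slack j) cs  ≡⟨ weightedSum-face (slack i) (slack j) (slack-nonNeg i)
                                                      face comb average≡0 ⟩
      0ℚ                        ∎)
      where
      i = fromℕ< p
      j = fromℕ< (pred< p)
      face : ∀ {v} → Admissible k a v → slack i v ≡ 0ℚ → slack j v ≡ 0ℚ
      face {v} adm = ≡a⇒slack≡0 j v ∘ Admissible.odd-cond adm m p odd ∘ slack≡0⇒≡a i v
      average≡0 : weightedSum (slack i) cs ≡ 0ℚ
      average≡0 = trans (barycentre-slack i) (≡a⇒slack≡0 i x xi≡ai)

    even-cond : ∀ m (p : suc m < k) → suc m % 2 ≡ 0 →
      x (fromℕ< p) ≡ + 0 → x (fromℕ< (pred< p)) ≡ + 0
    even-cond m p even xi≡0 = coord≡0⇒≡0 j x (begin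
      coord j x                 ≡⟨ barycentre j ⟨
      weightedSum (coord j) cs  ≡⟨ weightedSum-face (coord i) (coord j) (coord-nonNeg i)
                                                      face comb average≡0 ⟩
      0ℚ                        ∎)
      where
      i = fromℕ< p
      j = fromℕ< (pred< p)
      face : ∀ {v} → Admissible k a v → coord i v ≡ 0ℚ → coord j v ≡ 0ℚ
      face {v} adm = cong toℚ ∘ Admissible.even-cond adm m p even ∘ coord≡0⇒≡0 i v
      average≡0 : weightedSum (coord i) cs ≡ 0ℚ
      average≡0 = trans (barycentre i) (cong toℚ xi≡0)

theorem11p2 : (k : ℕ) → 1 ≤ k → (a : Fin k → ℕ) → ValidCF k a →
    (x : Fin k → ℤ) →
    (InConvexHull k (Admissible k a) (λ i → toℚ (x i)) → Admissible k a x)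
    × (Admissible k a x → InConvexHull k (Admissible k a) (λ i → toℚ (x i)))
theorem11p2 k _ a _ x = inConvexHull⇒admissible a x , ∈⇒inConvexHull
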